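{- Let $n_1,n_2$ be positive integers and let $G$ be an induced subgraph of the complete tripartite graph $K_{1,n_1,n_2}$. Then $\gamma_{\mathbb{R}}(G)\leq 2$.
   Context: For a graph $G$ and indeterminates $X_G=\{x_u : u\in V(G)\}$, the generalized Laplacian matrix $L(G,X_G)$ has $uu$-entry $x_u$ and $uv$-entry $-m_{uv}$ for $u\neq v$, where $m_{uv}$ is the number of edges between $u$ and $v$. The $i$-th critical ideal $I_i^{\mathbb{R}}(G,X_G)\subseteq\mathbb{R}[X_G]$ is generated by all $i\times i$ minors of $L(G,X_G)$; $\gamma_{\mathbb{R}}(G)$ (real algebraic co-rank) is the largest $i$ with $I_i^{\mathbb{R}}(G,X_G)=\langle 1\rangle$. -}

module Defs where

open import Level using (0ℓ)
open import Algebra.Bundles using (CommutativeRing)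
open import Relation.Binary.Structures using (IsTotalOrder)
open import Data.Nat as ℕ using (ℕ; zero; suc; _<ᵇ_)
open import Data.Bool using (Bool; true; false; if_then_else_)
open import Data.Fin as Fin using (Fin; zero; suc; punchIn; toℕ)
open import Data.List using (List; []; _∷_; map; foldr)
open import Data.Product using (Σ; ∃; _×_; _,_; proj₁)
open import Data.Unit using (⊤)
open import Relation.Nullary using (¬_; yes; no)
open import Relation.Binary.PropositionalEquality using (_≡_)
open import Function.Definitions using (Injective)

-- The real numbers, axiomatised as a complete ordered field
-- (unique up to isomorphism; stdlib has no ℝ).

record RealNumberField : Set₁ where
  field
    commRing : CommutativeRing 0ℓ 0ℓ
  open CommutativeRing commRing public
  field
    _≤ᵣ_         : Carrier → Carrier → Set
    0≉1          : ¬ (0# ≈ 1#)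
    inverse      : ∀ x → ¬ (x ≈ 0#) → ∃ λ y → (x * y) ≈ 1#
    isTotalOrder : IsTotalOrder _≈_ _≤ᵣ_
    +-mono-≤     : ∀ {x y} z → x ≤ᵣ y → (x + z) ≤ᵣ (y + z)
    *-nonneg     : ∀ {x y} → 0# ≤ᵣ x → 0# ≤ᵣ y → 0# ≤ᵣ (x * y)
    complete     : (S : Carrier → Set) → ∃ S →
                   (∃ λ b → ∀ x → S x → x ≤ᵣ b) →
                   ∃ λ s → (∀ x → S x → x ≤ᵣ s) ×
                           (∀ b → (∀ x → S x → x ≤ᵣ b) → s ≤ᵣ b)

record Multigraph (k : ℕ) : Set where
  field
    mult : Fin k → Fin k → ℕ
    sym  : ∀ u v → mult u v ≡ mult v u
open Multigraph public

-- The complete tripartite graph K_{1,n₁,n₂} on Fin (1 + n₁ + n₂):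
-- vertex 0 is part 0, the next n₁ vertices part 1, the last n₂ part 2.
K1-mult : (n₁ n₂ : ℕ) → Fin (suc (n₁ ℕ.+ n₂)) → Fin (suc (n₁ ℕ.+ n₂)) → ℕ
K1-mult n₁ n₂ u v with part (toℕ u) | part (toℕ v)
  where
  part : ℕ → ℕ
  part x = if x <ᵇ 1 then 0 else (if x <ᵇ suc n₁ then 1 else 2)
... | a | b with a ℕ.≟ b
... | yes _ = 0
... | no  _ = 1

IsInducedSubgraphOfK1 : ∀ {k} → Multigraph k → ℕ → ℕ → Set
IsInducedSubgraphOfK1 {k} G n₁ n₂ =
  Σ (Fin k → Fin (suc (n₁ ℕ.+ n₂))) λ f →
    Injective _≡_ _≡_ f × (∀ u v → mult G u v ≡ K1-mult n₁ n₂ (f u) (f v))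

-- Multivariate polynomials over a commutative ring, in k variables:
-- Poly (suc k) = univariate polynomials (coefficient lists, lowest degree
-- first) in x₀ with coefficients in Poly k (the variables x₁ … x_k).

module PolyRing (R : CommutativeRing 0ℓ 0ℓ) where
  open CommutativeRing R using (_≈_; _+_; _*_; -_; 0#; 1#) renaming (Carrier to A)

  Poly : ℕ → Set
  Poly zero    = A
  Poly (suc k) = List (Poly k)

  0P : ∀ k → Poly k
  0P zero    = 0#
  0P (suc k) = []

  cst : ∀ k → A → Poly k
  cst zero    a = a
  cst (suc k) a = cst k a ∷ []

  addP : ∀ k → Poly k → Poly k → Poly k
  addP zero    p        q        = p + q
  addP (suc k) []       q        = q
  addP (suc k) (p ∷ ps) []       = p ∷ ps
  addP (suc k) (p ∷ ps) (q ∷ qs) = addP k p q ∷ addP (suc k) ps qs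

  negP : ∀ k → Poly k → Poly k
  negP zero    p = - p
  negP (suc k) p = map (negP k) p

  mulP : ∀ k → Poly k → Poly k → Poly k
  mulP zero    p        q = p * q
  mulP (suc k) []       q = []
  mulP (suc k) (p ∷ ps) q =
    addP (suc k) (map (mulP k p) q) (0P k ∷ mulP (suc k) ps q)

  EqP : ∀ k → Poly k → Poly k → Set
  EqP zero    p        q        = p ≈ q
  EqP (suc k) []       []       = ⊤
  EqP (suc k) []       (q ∷ qs) = EqP k (0P k) q × EqP (suc k) [] qs
  EqP (suc k) (p ∷ ps) []       = EqP k p (0P k) × EqP (suc k) ps []
  EqP (suc k) (p ∷ ps) (q ∷ qs) = EqP k p q × EqP (suc k) ps qs

  var : ∀ k → Fin k → Poly k
  var (suc k) zero    = 0P k ∷ cst k 1# ∷ []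
  var (suc k) (suc i) = var k i ∷ []

  fromℕ : ℕ → A
  fromℕ zero    = 0#
  fromℕ (suc n) = 1# + fromℕ n

  sumFin : ∀ k n → (Fin n → Poly k) → Poly k
  sumFin k zero    f = 0P k
  sumFin k (suc n) f = addP k (f zero) (sumFin k n (λ j → f (suc j)))

  signed : ∀ k → ℕ → Poly k → Poly k
  signed k zero    p = p
  signed k (suc m) p = negP k (signed k m p)

  det : ∀ k n → (Fin n → Fin n → Poly k) → Poly k
  det k zero    M = cst k 1#
  det k (suc n) M = sumFin k (suc n) λ j →
    signed k (toℕ j)
      (mulP k (M zero j) (det k n (λ a b → M (suc a) (punchIn j b))))

  Increasing : ℕ → ℕ → Set
  Increasing i k = Σ (Fin i → Fin k) λ f → ∀ a b → a Fin.< b → f a Fin.< f b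

  module _ {k : ℕ} (G : Multigraph k) where

    L : Fin k → Fin k → Poly k
    L u v with u Fin.≟ v
    ... | yes _ = var k u
    ... | no  _ = negP k (cst k (fromℕ (mult G u v)))

    minor : ∀ {i} → Increasing i k → Increasing i k → Poly k
    minor {i} r c = det k i (λ a b → L (proj₁ r a) (proj₁ c b))

    CriticalIdealTrivial : ℕ → Set
    CriticalIdealTrivial i =
      Σ (List (Increasing i k × Increasing i k × Poly k)) λ cs →
        EqP k (foldr (addP k) (0P k)
                 (map (λ { (r , c , p) → mulP k p (minor r c) }) cs))
              (cst k 1#)

    -- γ_R(G) ≤ m  (γ_R(G) = largest i with I_i = ⟨1⟩)
    AlgCoRank≤ : ℕ → Set
    AlgCoRank≤ m = ∀ i → CriticalIdealTrivial i → i ℕ.≤ m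

γℝ≤ : (ℝ : RealNumberField) → ∀ {k} → Multigraph k → ℕ → Set
γℝ≤ ℝ G m = PolyRing.AlgCoRank≤ (RealNumberField.commRing ℝ) G m

-- Send every vertex of K_{1,n₁,n₂} to the part containing it, and let a, b be the
-- indicator vectors of P₀ ∪ P₁ and P₀ ∪ P₂.  For distinct vertices u, v the number of
-- edges between them is a(u) b(v) + b(u) a(v), since the apex is the only vertex of P₀.
-- Specialising x_u to -(a(u) b(u) + b(u) a(u)) therefore turns L(G, X_G) into the matrix
-- -(a bᵀ + b aᵀ) of rank at most 2, at which every minor of size at least 3 vanishes.
-- Evaluation at this point is a ring homomorphism R[X_G] → R, so it would send a
-- combination of such minors equal to 1 to 0 = 1.
module Submission where

open import Defs hiding (sym)
open import Data.Nat using (ℕ; _≤_)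

open import Level using (0ℓ)
open import Algebra.Bundles using (CommutativeRing; RawRing)
open import Algebra.Solver.Ring.AlmostCommutativeRing
  using (fromCommutativeRing; _-Raw-AlmostCommutative⟶_)
open import Data.Nat as ℕ using (zero; suc; _<ᵇ_; z≤n; s≤s)
import Data.Nat.Properties as ℕ
open import Data.Bool using (true; false; if_then_else_)
open import Data.Fin as Fin using (Fin; zero; suc; punchIn; toℕ; _↑ˡ_; _↑ʳ_)
open import Data.Vec using (tabulate; _++_)
open import Data.Vec.Functional using (tail)
open import Data.List using (List; []; _∷_; map; foldr)
open import Data.Maybe using (Maybe; just; nothing)
open import Data.Product using (_×_; _,_)
open import Function using (_∘_)
open import Data.Empty using (⊥-elim)
open import Relation.Nullary using (¬_; yes; no)
open import Relation.Binary.PropositionalEquality as ≡ using (_≡_)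

-- Integer coefficients are represented by pairs (m , n) standing for m - n.
module IntegerRingSolver {c ℓ} (R : CommutativeRing c ℓ) where
  open CommutativeRing R
  open import Algebra.Properties.Semiring.Mult.TCOptimised semiring
    using (×-homo-+; ×1-homo-*) renaming (_×_ to _×′_)
  open import Algebra.Properties.Ring ring using (-‿distribˡ-*; x[y-z]≈xy-xz)
  open import Algebra.Properties.AbelianGroup +-abelianGroup using (⁻¹-∙-comm; ⁻¹-anti-homo‿-)
  open import Algebra.Properties.Group +-group using (ε⁻¹≈ε)
  open import Algebra.Properties.CommutativeSemigroup +-commutativeSemigroup using (interchange)
  open import Relation.Binary.Reasoning.Setoid setoid

  ℕ² : RawRing 0ℓ 0ℓ
  ℕ² = record
    { Carrier = ℕ × ℕ
    ; _≈_     = _≡_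
    ; _+_     = λ { (a , b) (c , d) → a ℕ.+ c , b ℕ.+ d }
    ; _*_     = λ { (a , b) (c , d) → a ℕ.* c ℕ.+ b ℕ.* d , a ℕ.* d ℕ.+ b ℕ.* c }
    ; -_      = λ { (a , b) → b , a }
    ; 0#      = 0 , 0
    ; 1#      = 1 , 0
    }

  ι : ℕ → Carrier
  ι n = n ×′ 1#

  -- (0 , 0) and (1 , 0) denote 0# and 1# definitionally, which lets solver expressions
  -- unfold exactly to terms built from 0# and 1#.
  ⟦_⟧ᶻ : ℕ × ℕ → Carrier
  ⟦ m , zero ⟧ᶻ = ι m
  ⟦ m , n    ⟧ᶻ = ι m - ι n

  ⟦⟧ᶻ-difference : ∀ m n → ⟦ m , n ⟧ᶻ ≈ ι m - ι n
  ⟦⟧ᶻ-difference m zero    = sym (trans (+-congˡ ε⁻¹≈ε) (+-identityʳ (ι m)))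
  ⟦⟧ᶻ-difference m (suc n) = refl

  -‿+-interchange : ∀ a b c d → (a + c) - (b + d) ≈ (a - b) + (c - d)
  -‿+-interchange a b c d = trans (+-congˡ (sym (⁻¹-∙-comm b d))) (interchange a c (- b) (- d))

  ⟦⟧ᶻ-homo-+ : ∀ p q → ⟦ RawRing._+_ ℕ² p q ⟧ᶻ ≈ ⟦ p ⟧ᶻ + ⟦ q ⟧ᶻ
  ⟦⟧ᶻ-homo-+ (a , b) (c , d) = begin
    ⟦ a ℕ.+ c , b ℕ.+ d ⟧ᶻ      ≈⟨ ⟦⟧ᶻ-difference (a ℕ.+ c) (b ℕ.+ d) ⟩
    ι (a ℕ.+ c) - ι (b ℕ.+ d)   ≈⟨ +-cong (×-homo-+ 1# a c) (-‿cong (×-homo-+ 1# b d)) ⟩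
    (ι a + ι c) - (ι b + ι d)   ≈⟨ -‿+-interchange (ι a) (ι b) (ι c) (ι d) ⟩
    (ι a - ι b) + (ι c - ι d)   ≈⟨ sym (+-cong (⟦⟧ᶻ-difference a b) (⟦⟧ᶻ-difference c d)) ⟩
    ⟦ a , b ⟧ᶻ + ⟦ c , d ⟧ᶻ     ∎

  ⟦⟧ᶻ-homo-* : ∀ p q → ⟦ RawRing._*_ ℕ² p q ⟧ᶻ ≈ ⟦ p ⟧ᶻ * ⟦ q ⟧ᶻ
  ⟦⟧ᶻ-homo-* (a , b) (c , d) = begin
    ⟦ a ℕ.* c ℕ.+ b ℕ.* d , a ℕ.* d ℕ.+ b ℕ.* c ⟧ᶻ
      ≈⟨ ⟦⟧ᶻ-difference (a ℕ.* c ℕ.+ b ℕ.* d) (a ℕ.* d ℕ.+ b ℕ.* c) ⟩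
    ι (a ℕ.* c ℕ.+ b ℕ.* d) - ι (a ℕ.* d ℕ.+ b ℕ.* c)
      ≈⟨ +-cong (ι-+-* a c b d) (-‿cong (ι-+-* a d b c)) ⟩
    (ι a * ι c + ι b * ι d) - (ι a * ι d + ι b * ι c)
      ≈⟨ -‿+-interchange (ι a * ι c) (ι a * ι d) (ι b * ι d) (ι b * ι c) ⟩
    (ι a * ι c - ι a * ι d) + (ι b * ι d - ι b * ι c)
      ≈⟨ +-cong (sym (x[y-z]≈xy-xz (ι a) (ι c) (ι d)))
                (sym (⁻¹-anti-homo‿- (ι b * ι c) (ι b * ι d))) ⟩
    ι a * (ι c - ι d) + - (ι b * ι c - ι b * ι d)
      ≈⟨ +-congˡ (-‿cong (sym (x[y-z]≈xy-xz (ι b) (ι c) (ι d)))) ⟩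
    ι a * (ι c - ι d) + - (ι b * (ι c - ι d))
      ≈⟨ +-congˡ (-‿distribˡ-* (ι b) (ι c - ι d)) ⟩
    ι a * (ι c - ι d) + - ι b * (ι c - ι d)
      ≈⟨ sym (distribʳ (ι c - ι d) (ι a) (- ι b)) ⟩
    (ι a - ι b) * (ι c - ι d)
      ≈⟨ sym (*-cong (⟦⟧ᶻ-difference a b) (⟦⟧ᶻ-difference c d)) ⟩
    ⟦ a , b ⟧ᶻ * ⟦ c , d ⟧ᶻ ∎
    where
    ι-+-* : ∀ m n p q → ι (m ℕ.* n ℕ.+ p ℕ.* q) ≈ ι m * ι n + ι p * ι q
    ι-+-* m n p q = trans (×-homo-+ 1# (m ℕ.* n) (p ℕ.* q)) (+-cong (×1-homo-* m n) (×1-homo-* p q))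

  ⟦⟧ᶻ-homo-‿ : ∀ p → ⟦ RawRing.-_ ℕ² p ⟧ᶻ ≈ - ⟦ p ⟧ᶻ
  ⟦⟧ᶻ-homo-‿ (a , b) = begin
    ⟦ b , a ⟧ᶻ       ≈⟨ ⟦⟧ᶻ-difference b a ⟩
    ι b - ι a        ≈⟨ sym (⁻¹-anti-homo‿- (ι a) (ι b)) ⟩
    - (ι a - ι b)    ≈⟨ -‿cong (sym (⟦⟧ᶻ-difference a b)) ⟩
    - ⟦ a , b ⟧ᶻ     ∎

  ⟦⟧ᶻ-morphism : ℕ² -Raw-AlmostCommutative⟶ fromCommutativeRing R
  ⟦⟧ᶻ-morphism = record
    { ⟦_⟧    = ⟦_⟧ᶻ
    ; +-homo = ⟦⟧ᶻ-homo-+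
    ; *-homo = ⟦⟧ᶻ-homo-*
    ; -‿homo = ⟦⟧ᶻ-homo-‿
    ; 0-homo = refl
    ; 1-homo = refl
    }

  ⟦n,n⟧ᶻ≈0 : ∀ n → ⟦ n , n ⟧ᶻ ≈ 0#
  ⟦n,n⟧ᶻ≈0 n = trans (⟦⟧ᶻ-difference n n) (-‿inverseʳ (ι n))

  ⟦⟧ᶻ-cong : ∀ a b c d → a ℕ.+ d ≡ c ℕ.+ b → ⟦ a , b ⟧ᶻ ≈ ⟦ c , d ⟧ᶻ
  ⟦⟧ᶻ-cong a b c d a+d≡c+b = begin
    ⟦ a , b ⟧ᶻ                 ≈⟨ sym (trans (+-congˡ (⟦n,n⟧ᶻ≈0 d)) (+-identityʳ _)) ⟩
    ⟦ a , b ⟧ᶻ + ⟦ d , d ⟧ᶻ    ≈⟨ sym (⟦⟧ᶻ-homo-+ (a , b) (d , d)) ⟩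
    ⟦ a ℕ.+ d , b ℕ.+ d ⟧ᶻ     ≡⟨ ≡.cong₂ (λ m n → ⟦ m , n ⟧ᶻ) a+d≡c+b (ℕ.+-comm b d) ⟩
    ⟦ c ℕ.+ b , d ℕ.+ b ⟧ᶻ     ≈⟨ ⟦⟧ᶻ-homo-+ (c , d) (b , b) ⟩
    ⟦ c , d ⟧ᶻ + ⟦ b , b ⟧ᶻ    ≈⟨ trans (+-congˡ (⟦n,n⟧ᶻ≈0 b)) (+-identityʳ _) ⟩
    ⟦ c , d ⟧ᶻ                 ∎

  _≟ᶻ_ : ∀ p q → Maybe (⟦ p ⟧ᶻ ≈ ⟦ q ⟧ᶻ)
  (a , b) ≟ᶻ (c , d) with a ℕ.+ d ℕ.≟ c ℕ.+ b
  ... | yes a+d≡c+b = just (⟦⟧ᶻ-cong a b c d a+d≡c+b)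
  ... | no  _       = nothing

  open import Algebra.Solver.Ring ℕ² (fromCommutativeRing R) ⟦⟧ᶻ-morphism _≟ᶻ_ public

data Part : Set where
  P₀ P₁ P₂ : Part

-- The same case split as in the definition of K1-mult, so that K1-mult≡differ can split on it.
part : ∀ n₁ {n₂} → Fin (suc (n₁ ℕ.+ n₂)) → Part
part n₁ w = if toℕ w <ᵇ 1 then P₀ else (if toℕ w <ᵇ suc n₁ then P₁ else P₂)

differ : Part → Part → ℕ
differ P₀ P₀ = 0
differ P₁ P₁ = 0
differ P₂ P₂ = 0
differ _  _  = 1

K1-mult≡differ : ∀ n₁ n₂ u v → K1-mult n₁ n₂ u v ≡ differ (part n₁ u) (part n₁ v)
K1-mult≡differ n₁ n₂ u v with toℕ u <ᵇ 1 | toℕ u <ᵇ suc n₁ | toℕ v <ᵇ 1 | toℕ v <ᵇ suc n₁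
... | true  | _     | true  | _     = ≡.refl
... | true  | _     | false | true  = ≡.refl
... | true  | _     | false | false = ≡.refl
... | false | true  | true  | _     = ≡.refl
... | false | true  | false | true  = ≡.refl
... | false | true  | false | false = ≡.refl
... | false | false | true  | _     = ≡.refl
... | false | false | false | true  = ≡.refl
... | false | false | false | false = ≡.refl

part≡P₀⇒≡zero : ∀ n₁ {n₂} (w : Fin (suc (n₁ ℕ.+ n₂))) → part n₁ w ≡ P₀ → w ≡ zero
part≡P₀⇒≡zero n₁ zero    _ = ≡.refl
part≡P₀⇒≡zero n₁ (suc w) _ with toℕ w <ᵇ n₁
part≡P₀⇒≡zero n₁ (suc w) () | true
part≡P₀⇒≡zero n₁ (suc w) () | false

𝟙₀₁ 𝟙₀₂ : Part → ℕ
𝟙₀₁ P₀ = 1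
𝟙₀₁ P₁ = 1
𝟙₀₁ P₂ = 0
𝟙₀₂ P₀ = 1
𝟙₀₂ P₁ = 0
𝟙₀₂ P₂ = 1

crossing : Part → Part → ℕ
crossing p q = 𝟙₀₁ p ℕ.* 𝟙₀₂ q ℕ.+ 𝟙₀₂ p ℕ.* 𝟙₀₁ q

differ≡crossing : ∀ p q → ¬ (p ≡ P₀ × q ≡ P₀) → differ p q ≡ crossing p q
differ≡crossing P₀ P₀ not-both-P₀ = ⊥-elim (not-both-P₀ (≡.refl , ≡.refl))
differ≡crossing P₀ P₁ _ = ≡.refl
differ≡crossing P₀ P₂ _ = ≡.refl
differ≡crossing P₁ P₀ _ = ≡.refl
differ≡crossing P₁ P₁ _ = ≡.refl
differ≡crossing P₁ P₂ _ = ≡.refl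
differ≡crossing P₂ P₀ _ = ≡.refl
differ≡crossing P₂ P₁ _ = ≡.refl
differ≡crossing P₂ P₂ _ = ≡.refl

module _ (R : CommutativeRing 0ℓ 0ℓ) where
  open CommutativeRing R hiding (zero) renaming (Carrier to A)
  open PolyRing R
  module S = IntegerRingSolver R
  open S using (solve; _:=_; _:+_; _:*_; :-_; con)
  open import Algebra.Properties.Semiring.Mult semiring
    using (×-homo-+; ×1-homo-*) renaming (_×_ to _×ᴿ_)
  open import Algebra.Properties.Group +-group using (ε⁻¹≈ε)
  open import Relation.Binary.Reasoning.Setoid setoid

  -- Determinants over R (a polynomial ring in zero variables is R itself)

  sumFin-cong : ∀ n (f g : Fin n → A) → (∀ j → f j ≈ g j) → sumFin 0 n f ≈ sumFin 0 n g
  sumFin-cong zero    f g f≈g = refl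
  sumFin-cong (suc n) f g f≈g = +-cong (f≈g zero) (sumFin-cong n _ _ (λ j → f≈g (suc j)))

  sumFin-zero : ∀ n (f : Fin n → A) → (∀ j → f j ≈ 0#) → sumFin 0 n f ≈ 0#
  sumFin-zero zero    f f≈0 = refl
  sumFin-zero (suc n) f f≈0 =
    trans (+-cong (f≈0 zero) (sumFin-zero n _ (λ j → f≈0 (suc j)))) (+-identityʳ 0#)

  signed-cong : ∀ m {x y} → x ≈ y → signed 0 m x ≈ signed 0 m y
  signed-cong zero    x≈y = x≈y
  signed-cong (suc m) x≈y = -‿cong (signed-cong m x≈y)

  signed-zero : ∀ m x → x ≈ 0# → signed 0 m x ≈ 0#
  signed-zero zero    x x≈0 = x≈0
  signed-zero (suc m) x x≈0 = trans (-‿cong (signed-zero m x x≈0)) ε⁻¹≈ε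

  expansionTerm : ∀ k n → (Fin (suc n) → Fin (suc n) → Poly k) → Fin (suc n) → Poly k
  expansionTerm k n M j = signed k (toℕ j) (mulP k (M zero j) (det k n (λ a b → M (suc a) (punchIn j b))))

  det-cong : ∀ n (M N : Fin n → Fin n → A) → (∀ a b → M a b ≈ N a b) → det 0 n M ≈ det 0 n N
  det-cong zero    M N M≈N = refl
  det-cong (suc n) M N M≈N = sumFin-cong (suc n) (expansionTerm 0 n M) (expansionTerm 0 n N) λ j →
    signed-cong (toℕ j) (*-cong (M≈N zero j) (det-cong n _ _ (λ a b → M≈N (suc a) (punchIn j b))))

  -- det mirrored on solver expressions; its denotation unfolds to det 0.
  detExpr : ∀ {v} n → (Fin n → Fin n → S.Polynomial v) → S.Polynomial v
  detExpr zero    M = con (1 , 0)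
  detExpr (suc n) M = sumExpr (suc n) λ j →
      signedExpr (toℕ j) (M zero j :* detExpr n (λ a b → M (suc a) (punchIn j b)))
    where
    sumExpr : ∀ {v} n → (Fin n → S.Polynomial v) → S.Polynomial v
    sumExpr zero    f = con (0 , 0)
    sumExpr (suc n) f = f zero :+ sumExpr n (λ j → f (suc j))
    signedExpr : ∀ {v} → ℕ → S.Polynomial v → S.Polynomial v
    signedExpr zero    p = p
    signedExpr (suc m) p = :- signedExpr m p

  det₃-rank≤2 : (X Y Z W : Fin 3 → A) → det 0 3 (λ a b → X a * Y b + Z a * W b) ≈ 0#
  det₃-rank≤2 X Y Z W =
    S.prove (tabulate X ++ tabulate Y ++ tabulate Z ++ tabulate W) (detExpr 3 XY+ZW) (con (0 , 0)) refl
    where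
    XY+ZW : Fin 3 → Fin 3 → S.Polynomial 12
    XY+ZW a b = S.var (a ↑ˡ 9) :* S.var (3 ↑ʳ (b ↑ˡ 6))
            :+ S.var (6 ↑ʳ (a ↑ˡ 3)) :* S.var (9 ↑ʳ b)

  -- Expanding along the first row reduces to the 3 × 3 case, as the minors keep the shape X Yᵀ + Z Wᵀ.
  det-rank≤2 : ∀ m (X Y Z W : Fin (3 ℕ.+ m) → A) →
    det 0 (3 ℕ.+ m) (λ a b → X a * Y b + Z a * W b) ≈ 0#
  det-rank≤2 zero    X Y Z W = det₃-rank≤2 X Y Z W
  det-rank≤2 (suc m) X Y Z W = sumFin-zero (suc (3 ℕ.+ m)) (expansionTerm 0 (3 ℕ.+ m) XY+ZW) λ j →
    signed-zero (toℕ j) _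
      (trans (*-congˡ (det-rank≤2 m (tail X) (λ b → Y (punchIn j b)) (tail Z) (λ b → W (punchIn j b))))
             (zeroʳ _))
    where
    XY+ZW : Fin (suc (3 ℕ.+ m)) → Fin (suc (3 ℕ.+ m)) → A
    XY+ZW a b = X a * Y b + Z a * W b

  -- Evaluation of polynomials at a point

  eval : ∀ k → (Fin k → A) → Poly k → A
  eval zero    ρ a        = a
  eval (suc k) ρ []       = 0#
  eval (suc k) ρ (c ∷ cs) = eval k (tail ρ) c + ρ zero * eval (suc k) ρ cs

  eval-0P : ∀ k ρ → eval k ρ (0P k) ≈ 0#
  eval-0P zero    ρ = refl
  eval-0P (suc k) ρ = refl

  eval-cst : ∀ k ρ a → eval k ρ (cst k a) ≈ a
  eval-cst zero    ρ a = refl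
  eval-cst (suc k) ρ a = trans (+-cong (eval-cst k (tail ρ) a) (zeroʳ _)) (+-identityʳ a)

  eval-∷-zero : ∀ k ρ c cs → eval k (tail ρ) c ≈ 0# → eval (suc k) ρ cs ≈ 0# →
    eval (suc k) ρ (c ∷ cs) ≈ 0#
  eval-∷-zero k ρ c cs c≈0 cs≈0 =
    trans (+-cong c≈0 (*-congˡ cs≈0)) (trans (+-identityˡ _) (zeroʳ _))

  EqP⇒eval≈ : ∀ k ρ p q → EqP k p q → eval k ρ p ≈ eval k ρ q
  EqP⇒eval≈ zero    ρ p        q        p≈q          = p≈q
  EqP⇒eval≈ (suc k) ρ []       []       _            = refl
  EqP⇒eval≈ (suc k) ρ []       (q ∷ qs) (0≈q , []≈qs) = sym (eval-∷-zero k ρ q qs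
    (sym (trans (sym (eval-0P k (tail ρ))) (EqP⇒eval≈ k (tail ρ) (0P k) q 0≈q)))
    (sym (EqP⇒eval≈ (suc k) ρ [] qs []≈qs)))
  EqP⇒eval≈ (suc k) ρ (p ∷ ps) []       (p≈0 , ps≈[]) = eval-∷-zero k ρ p ps
    (trans (EqP⇒eval≈ k (tail ρ) p (0P k) p≈0) (eval-0P k (tail ρ)))
    (EqP⇒eval≈ (suc k) ρ ps [] ps≈[])
  EqP⇒eval≈ (suc k) ρ (p ∷ ps) (q ∷ qs) (p≈q , ps≈qs) =
    +-cong (EqP⇒eval≈ k (tail ρ) p q p≈q) (*-congˡ (EqP⇒eval≈ (suc k) ρ ps qs ps≈qs))

  eval-addP : ∀ k ρ p q → eval k ρ (addP k p q) ≈ eval k ρ p + eval k ρ q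
  eval-addP zero    ρ p        q        = refl
  eval-addP (suc k) ρ []       q        = sym (+-identityˡ _)
  eval-addP (suc k) ρ (p ∷ ps) []       = sym (+-identityʳ _)
  eval-addP (suc k) ρ (p ∷ ps) (q ∷ qs) = begin
    eval k (tail ρ) (addP k p q) + ρ zero * eval (suc k) ρ (addP (suc k) ps qs)
      ≈⟨ +-cong (eval-addP k (tail ρ) p q) (*-congˡ (eval-addP (suc k) ρ ps qs)) ⟩
    (eval k (tail ρ) p + eval k (tail ρ) q) + ρ zero * (eval (suc k) ρ ps + eval (suc k) ρ qs)
      ≈⟨ solve 5 (λ a b x c d → (a :+ b) :+ x :* (c :+ d) := (a :+ x :* c) :+ (b :+ x :* d)) refl
           _ _ _ _ _ ⟩
    (eval k (tail ρ) p + ρ zero * eval (suc k) ρ ps)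
      + (eval k (tail ρ) q + ρ zero * eval (suc k) ρ qs) ∎

  eval-negP : ∀ k ρ p → eval k ρ (negP k p) ≈ - eval k ρ p
  eval-negP zero    ρ p        = refl
  eval-negP (suc k) ρ []       = sym ε⁻¹≈ε
  eval-negP (suc k) ρ (p ∷ ps) = begin
    eval k (tail ρ) (negP k p) + ρ zero * eval (suc k) ρ (negP (suc k) ps)
      ≈⟨ +-cong (eval-negP k (tail ρ) p) (*-congˡ (eval-negP (suc k) ρ ps)) ⟩
    - eval k (tail ρ) p + ρ zero * - eval (suc k) ρ ps
      ≈⟨ solve 3 (λ a x c → :- a :+ x :* :- c := :- (a :+ x :* c)) refl _ _ _ ⟩
    - (eval k (tail ρ) p + ρ zero * eval (suc k) ρ ps) ∎

  mutual
    eval-mulP : ∀ k ρ p q → eval k ρ (mulP k p q) ≈ eval k ρ p * eval k ρ q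
    eval-mulP zero    ρ p        q = refl
    eval-mulP (suc k) ρ []       q = sym (zeroˡ _)
    eval-mulP (suc k) ρ (p ∷ ps) q = begin
      eval (suc k) ρ (addP (suc k) (map (mulP k p) q) (0P k ∷ mulP (suc k) ps q))
        ≈⟨ eval-addP (suc k) ρ (map (mulP k p) q) (0P k ∷ mulP (suc k) ps q) ⟩
      eval (suc k) ρ (map (mulP k p) q)
        + (eval k (tail ρ) (0P k) + ρ zero * eval (suc k) ρ (mulP (suc k) ps q))
        ≈⟨ +-cong (eval-map-mulP k ρ p q)
                  (+-cong (eval-0P k (tail ρ)) (*-congˡ (eval-mulP (suc k) ρ ps q))) ⟩
      eval k (tail ρ) p * eval (suc k) ρ q + (0# + ρ zero * (eval (suc k) ρ ps * eval (suc k) ρ q))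
        ≈⟨ solve 4 (λ a b x c → a :* b :+ (con (0 , 0) :+ x :* (c :* b)) := (a :+ x :* c) :* b) refl
             _ _ _ _ ⟩
      (eval k (tail ρ) p + ρ zero * eval (suc k) ρ ps) * eval (suc k) ρ q ∎

    eval-map-mulP : ∀ k ρ p q →
      eval (suc k) ρ (map (mulP k p) q) ≈ eval k (tail ρ) p * eval (suc k) ρ q
    eval-map-mulP k ρ p []       = sym (zeroʳ _)
    eval-map-mulP k ρ p (c ∷ cs) = begin
      eval k (tail ρ) (mulP k p c) + ρ zero * eval (suc k) ρ (map (mulP k p) cs)
        ≈⟨ +-cong (eval-mulP k (tail ρ) p c) (*-congˡ (eval-map-mulP k ρ p cs)) ⟩
      eval k (tail ρ) p * eval k (tail ρ) c + ρ zero * (eval k (tail ρ) p * eval (suc k) ρ cs)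
        ≈⟨ solve 4 (λ a b x c → a :* b :+ x :* (a :* c) := a :* (b :+ x :* c)) refl _ _ _ _ ⟩
      eval k (tail ρ) p * (eval k (tail ρ) c + ρ zero * eval (suc k) ρ cs) ∎

  eval-var : ∀ k ρ i → eval k ρ (var k i) ≈ ρ i
  eval-var (suc k) ρ zero = begin
    eval k (tail ρ) (0P k) + ρ zero * (eval k (tail ρ) (cst k 1#) + ρ zero * 0#)
      ≈⟨ +-cong (eval-0P k (tail ρ)) (*-congˡ (+-congʳ (eval-cst k (tail ρ) 1#))) ⟩
    0# + ρ zero * (1# + ρ zero * 0#)
      ≈⟨ solve 1 (λ x → con (0 , 0) :+ x :* (con (1 , 0) :+ x :* con (0 , 0)) := x) refl _ ⟩
    ρ zero ∎
  eval-var (suc k) ρ (suc i) = trans (+-cong (eval-var k (tail ρ) i) (zeroʳ _)) (+-identityʳ _)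

  eval-sumFin : ∀ k ρ n f → eval k ρ (sumFin k n f) ≈ sumFin 0 n (λ j → eval k ρ (f j))
  eval-sumFin k ρ zero    f = eval-0P k ρ
  eval-sumFin k ρ (suc n) f = trans (eval-addP k ρ _ _) (+-congˡ (eval-sumFin k ρ n (λ j → f (suc j))))

  eval-signed : ∀ k ρ m p → eval k ρ (signed k m p) ≈ signed 0 m (eval k ρ p)
  eval-signed k ρ zero    p = refl
  eval-signed k ρ (suc m) p = trans (eval-negP k ρ _) (-‿cong (eval-signed k ρ m p))

  eval-det : ∀ k ρ n M → eval k ρ (det k n M) ≈ det 0 n (λ a b → eval k ρ (M a b))
  eval-det k ρ zero    M = eval-cst k ρ 1#
  eval-det k ρ (suc n) M = trans (eval-sumFin k ρ (suc n) (expansionTerm k n M))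
    (sumFin-cong (suc n) (λ j → eval k ρ (expansionTerm k n M j))
                         (expansionTerm 0 n (λ a b → eval k ρ (M a b))) λ j →
    trans (eval-signed k ρ (toℕ j) _) (signed-cong (toℕ j)
      (trans (eval-mulP k ρ (M zero j) _) (*-congˡ (eval-det k ρ n (λ a b → M (suc a) (punchIn j b)))))))

  -- Critical ideals

  record Rank≤2Specialisation {k} (G : Multigraph k) : Set where
    field
      point      : Fin k → A
      x y z w    : Fin k → A
      factorises : ∀ u v → eval k point (L G u v) ≈ x u * y v + z u * w v

  module _ (0≉1 : ¬ 0# ≈ 1#) {k} (G : Multigraph k) where

    minors≈0⇒¬CriticalIdealTrivial : ∀ {i} ρ →
      (∀ r c → eval k ρ (minor G {i} r c) ≈ 0#) → ¬ CriticalIdealTrivial G i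
    minors≈0⇒¬CriticalIdealTrivial {i} ρ minors≈0 (cs , Σcs≈1) = 0≉1 (begin
      0#                        ≈⟨ sym (eval-combination cs) ⟩
      eval k ρ (combination cs) ≈⟨ EqP⇒eval≈ k ρ _ _ Σcs≈1 ⟩
      eval k ρ (cst k 1#)       ≈⟨ eval-cst k ρ 1# ⟩
      1#                        ∎)
      where
      combination : List (Increasing i k × Increasing i k × Poly k) → Poly k
      combination cs = foldr (addP k) (0P k) (map (λ { (r , c , p) → mulP k p (minor G r c) }) cs)
      eval-combination : ∀ cs → eval k ρ (combination cs) ≈ 0#
      eval-combination []              = eval-0P k ρ
      eval-combination ((r , c , p) ∷ cs) = begin
        eval k ρ (addP k (mulP k p (minor G r c)) (combination cs))
          ≈⟨ eval-addP k ρ _ _ ⟩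
        eval k ρ (mulP k p (minor G r c)) + eval k ρ (combination cs)
          ≈⟨ +-cong (trans (eval-mulP k ρ p _) (*-congˡ (minors≈0 r c))) (eval-combination cs) ⟩
        eval k ρ p * 0# + 0#
          ≈⟨ trans (+-identityʳ _) (zeroʳ _) ⟩
        0# ∎

    Rank≤2Specialisation⇒AlgCoRank≤2 : Rank≤2Specialisation G → AlgCoRank≤ G 2
    Rank≤2Specialisation⇒AlgCoRank≤2 s = bound
      where
      open Rank≤2Specialisation s
      bound : ∀ i → CriticalIdealTrivial G i → i ≤ 2
      bound 0 _ = z≤n
      bound 1 _ = s≤s z≤n
      bound 2 _ = s≤s (s≤s z≤n)
      bound (suc (suc (suc m))) trivial =
        ⊥-elim (minors≈0⇒¬CriticalIdealTrivial point minors≈0 trivial)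
        where
        minors≈0 : ∀ r c → eval k point (minor G r c) ≈ 0#
        minors≈0 (r , _) (c , _) =
          trans (eval-det k point (3 ℕ.+ m) (λ a b → L G (r a) (c b)))
            (trans (det-cong (3 ℕ.+ m) _ (λ a b → x (r a) * y (c b) + z (r a) * w (c b))
                     (λ a b → factorises (r a) (c b)))
                   (det-rank≤2 m (x ∘ r) (y ∘ c) (z ∘ r) (w ∘ c)))

  fromℕ≈×1 : ∀ n → fromℕ n ≈ n ×ᴿ 1#
  fromℕ≈×1 zero    = refl
  fromℕ≈×1 (suc n) = +-congˡ (fromℕ≈×1 n)

  -fromℕ-+-* : ∀ a b c d →
    - fromℕ (a ℕ.* b ℕ.+ c ℕ.* d) ≈ (- fromℕ a) * fromℕ b + (- fromℕ c) * fromℕ d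
  -fromℕ-+-* a b c d = begin
    - fromℕ (a ℕ.* b ℕ.+ c ℕ.* d)
      ≈⟨ -‿cong (trans (fromℕ≈×1 (a ℕ.* b ℕ.+ c ℕ.* d)) (×-homo-+ 1# (a ℕ.* b) (c ℕ.* d))) ⟩
    - ((a ℕ.* b) ×ᴿ 1# + (c ℕ.* d) ×ᴿ 1#)
      ≈⟨ -‿cong (+-cong (×1-homo-* a b) (×1-homo-* c d)) ⟩
    - (a ×ᴿ 1# * b ×ᴿ 1# + c ×ᴿ 1# * d ×ᴿ 1#)
      ≈⟨ solve 4 (λ a b c d → :- (a :* b :+ c :* d) := (:- a) :* b :+ (:- c) :* d) refl _ _ _ _ ⟩
    (- a ×ᴿ 1#) * b ×ᴿ 1# + (- c ×ᴿ 1#) * d ×ᴿ 1#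
      ≈⟨ sym (+-cong (*-cong (-‿cong (fromℕ≈×1 a)) (fromℕ≈×1 b))
                     (*-cong (-‿cong (fromℕ≈×1 c)) (fromℕ≈×1 d))) ⟩
    (- fromℕ a) * fromℕ b + (- fromℕ c) * fromℕ d ∎

  inducedSubgraphOfK1⇒Rank≤2Specialisation : ∀ {n₁ n₂ k} (G : Multigraph k) →
    IsInducedSubgraphOfK1 G n₁ n₂ → Rank≤2Specialisation G
  inducedSubgraphOfK1⇒Rank≤2Specialisation {n₁} {n₂} {k} G (f , f-injective , f-mult) = record
    { point      = point
    ; x          = λ u → - fromℕ (𝟙₀₁ (t u))
    ; y          = λ v → fromℕ (𝟙₀₂ (t v))
    ; z          = λ u → - fromℕ (𝟙₀₂ (t u))
    ; w          = λ v → fromℕ (𝟙₀₁ (t v))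
    ; factorises = λ u v →
        trans (entry u v) (-fromℕ-+-* (𝟙₀₁ (t u)) (𝟙₀₂ (t v)) (𝟙₀₂ (t u)) (𝟙₀₁ (t v)))
    }
    where
    t : Fin k → Part
    t u = part n₁ (f u)

    point : Fin k → A
    point u = - fromℕ (crossing (t u) (t u))

    not-both-P₀ : ∀ {u v} → ¬ u ≡ v → ¬ (t u ≡ P₀ × t v ≡ P₀)
    not-both-P₀ {u} {v} u≢v (tu≡P₀ , tv≡P₀) =
      u≢v (f-injective (≡.trans (part≡P₀⇒≡zero n₁ (f u) tu≡P₀) (≡.sym (part≡P₀⇒≡zero n₁ (f v) tv≡P₀))))

    mult≡crossing : ∀ {u v} → ¬ u ≡ v → mult G u v ≡ crossing (t u) (t v)
    mult≡crossing {u} {v} u≢v = ≡.trans (f-mult u v)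
      (≡.trans (K1-mult≡differ n₁ n₂ (f u) (f v)) (differ≡crossing (t u) (t v) (not-both-P₀ u≢v)))

    entry : ∀ u v → eval k point (L G u v) ≈ - fromℕ (crossing (t u) (t v))
    entry u v with u Fin.≟ v
    ... | yes ≡.refl = eval-var k point u
    ... | no  u≢v    = trans (eval-negP k point _)
      (-‿cong (trans (eval-cst k point _) (reflexive (≡.cong fromℕ (mult≡crossing u≢v)))))

-- The bound holds for all n₁ and n₂.
mainTheorem5 : (ℝ : RealNumberField) (n₁ n₂ : ℕ) → 1 ≤ n₁ → 1 ≤ n₂ →
    ∀ {k} (G : Multigraph k) → IsInducedSubgraphOfK1 G n₁ n₂ →
    γℝ≤ ℝ G 2
mainTheorem5 ℝ n₁ n₂ _ _ G induced =
  Rank≤2Specialisation⇒AlgCoRank≤2 commRing 0≉1 G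
    (inducedSubgraphOfK1⇒Rank≤2Specialisation commRing G induced)
  where open RealNumberField ℝ using (commRing; 0≉1)
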